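{- Let $k$ be a positive integer which is not a perfect square. Then a graph $G$ admits a strongly $k$-uniform integer additive set-indexer if and only if $G$ is bipartite or a union of disjoint bipartite components.
   Context: All graphs are simple, finite and have no isolated vertices. Set-labels are non-empty finite subsets of the non-negative integers $\mathbb{N}_0$. For sets $A,B$, $A+B=\{a+b: a\in A, b\in B\}$. An integer additive set-indexer (IASI) of $G$ is an injective $f:V(G)\to 2^{\mathbb{N}_0}$ such that $f^+:E(G)\to 2^{\mathbb{N}_0}$, $f^+(uv)=f(u)+f(v)$, is injective. An IASI is strong if $|f^+(uv)|=|f(u)|\,|f(v)|$ for every edge $uv$, and strongly $k$-uniform if it is strong and $|f^+(e)|=k$ for every edge $e$. -}

module Defs where

open import Data.Nat using (ℕ; _+_; _*_; _>_)
open import Data.Nat.Properties using (_≟_)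
open import Data.Fin using (Fin)
open import Data.Bool using (Bool; true)
open import Data.List using (List; []; length; deduplicate; cartesianProductWith)
open import Data.List.Membership.Propositional using (_∈_)
open import Data.Product using (Σ; ∃; _×_; _,_)
open import Data.Sum using (_⊎_)
open import Relation.Binary.PropositionalEquality using (_≡_; _≢_)
open import Relation.Nullary using (¬_)

record Graph : Set where
  field
    n     : ℕ
    adj   : Fin n → Fin n → Bool
    sym   : ∀ u v → adj u v ≡ adj v u
    irrefl : ∀ u → adj u u ≢ true
    noIsolated : ∀ u → ∃ λ v → adj u v ≡ true

module _ (G : Graph) where
  open Graph G

  Edge : Fin n → Fin n → Set
  Edge u v = adj u v ≡ true

  Bipartite : Set
  Bipartite = Σ (Fin n → Bool) λ c → ∀ u v → Edge u v → c u ≢ c v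

-- Finite subsets of ℕ, represented by a list enumerating their elements
-- (order and repetitions irrelevant).

FinSet : Set
FinSet = List ℕ

_≐_ : FinSet → FinSet → Set
A ≐ B = ∀ x → (x ∈ A → x ∈ B) × (x ∈ B → x ∈ A)

card : FinSet → ℕ
card A = length (deduplicate _≟_ A)

_⊕_ : FinSet → FinSet → FinSet
A ⊕ B = cartesianProductWith _+_ A B

module _ (G : Graph) where
  open Graph G

  record IASI : Set where
    field
      f        : Fin n → FinSet
      nonEmpty : ∀ u → f u ≢ []
      f-inj    : ∀ u v → f u ≐ f v → u ≡ v
      f⁺-inj   : ∀ u v u' v' → Edge G u v → Edge G u' v' →
                 (f u ⊕ f v) ≐ (f u' ⊕ f v') →
                 (u ≡ u' × v ≡ v') ⊎ (u ≡ v' × v ≡ u')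

  IsStrong : IASI → Set
  IsStrong I = ∀ u v → Edge G u v → card (f u ⊕ f v) ≡ card (f u) * card (f v)
    where open IASI I

  IsStronglyUniform : ℕ → IASI → Set
  IsStronglyUniform k I = IsStrong I × (∀ u v → Edge G u v → card (f u ⊕ f v) ≡ k)
    where open IASI I

  HasStronglyUniformIASI : ℕ → Set
  HasStronglyUniformIASI k = Σ IASI (IsStronglyUniform k)

IsPerfectSquare : ℕ → Set
IsPerfectSquare k = ∃ λ m → m * m ≡ k

-- If f is strongly k-uniform, every edge uv has |f u| · |f v| = k.  As k is not
-- a square, exactly one of the two factors lies below √k, so colouring each
-- vertex by whether |f u| < √k is a proper 2-colouring.  Conversely, given a
-- 2-colouring of G on vertex set {0, …, n-1}, label each vertex w of the first
-- colour by {w} and each vertex w of the second colour by k numbers whose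
-- base-n digits are (0, w, t+1), t < k; every element of f u + f v then has
-- digits (p, q, t+1) with p, q the two ends of the edge, so all required
-- injectivities reduce to uniqueness of base-n digits.
module Submission where

open import Defs
open import Data.Nat using (ℕ; suc; _+_; _*_; _%_; _<_; _>_; _<?_; z≤n; s≤s; NonZero; >-nonZero)
open import Data.Nat.Properties
open import Data.Nat.DivMod using ([m+kn]%n≡m%n; m<n⇒m%n≡m)
open import Data.Fin using (Fin; toℕ)
open import Data.Fin.Properties using (toℕ<n; toℕ-injective)
open import Data.Bool using (Bool; true; false)
open import Data.List using (List; []; _∷_; [_]; length; map; upTo; deduplicate)
open import Data.List.Properties
  using (++-identityʳ; filter-all; length-map; length-upTo; map-∘; map-cong)
open import Data.List.Membership.Propositional using (_∈_)
open import Data.List.Membership.Propositional.Properties using (∈-map⁺; ∈-map⁻; ∈-upTo⁺)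
open import Data.List.Relation.Unary.Any.Properties using (¬Any[])
open import Data.List.Relation.Unary.Unique.Propositional using (Unique; []; _∷_)
open import Data.List.Relation.Unary.Unique.Propositional.Properties using (upTo⁺; map⁺)
open import Data.Product using (Σ; _×_; _,_; proj₁; proj₂)
open import Data.Sum using (_⊎_; inj₁; inj₂)
open import Function using (_∘_)
open import Function.Bundles using (_⇔_; mk⇔)
open import Relation.Nullary using (¬_; yes; no; ¬?; contradiction)
open import Relation.Nullary.Decidable using (⌊_⌋)
open import Relation.Binary.PropositionalEquality hiding ([_])

deduplicate-unique : ∀ {xs : List ℕ} → Unique xs → deduplicate _≟_ xs ≡ xs
deduplicate-unique []                      = refl
deduplicate-unique {x ∷ _} (x∉xs ∷ unique) rewrite deduplicate-unique unique =
  cong (x ∷_) (filter-all (¬? ∘ (x ≟_)) x∉xs)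

card-map-upTo : ∀ {f : ℕ → ℕ} → (∀ {i j} → f i ≡ f j → i ≡ j) →
                ∀ m → card (map f (upTo m)) ≡ m
card-map-upTo {f} f-inj m = begin
  card (map f (upTo m))   ≡⟨ cong length (deduplicate-unique (map⁺ f-inj (upTo⁺ m))) ⟩
  length (map f (upTo m)) ≡⟨ length-map f (upTo m) ⟩
  length (upTo m)         ≡⟨ length-upTo m ⟩
  m                       ∎
  where open ≡-Reasoning

⊕-singletonˡ : ∀ a ys → [ a ] ⊕ ys ≡ map (a +_) ys
⊕-singletonˡ a ys = ++-identityʳ (map (a +_) ys)

⊕-singletonʳ : ∀ xs b → xs ⊕ [ b ] ≡ map (_+ b) xs
⊕-singletonʳ []       b = refl
⊕-singletonʳ (x ∷ xs) b = cong (x + b ∷_) (⊕-singletonʳ xs b)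

digits-unique : ∀ {n a a'} m m' → a < n → a' < n →
                a + m * n ≡ a' + m' * n → a ≡ a' × m ≡ m'
digits-unique {n} {a} {a'} m m' a<n a'<n eq =
  a≡a' , *-cancelʳ-≡ m m' n (+-cancelˡ-≡ a _ _ (trans eq (cong (_+ m' * n) (sym a≡a'))))
  where
  instance
    n≢0 : NonZero n
    n≢0 = >-nonZero (≤-<-trans z≤n a<n)
  open ≡-Reasoning
  a≡a' : a ≡ a'
  a≡a' = begin
    a                ≡⟨ m<n⇒m%n≡m a<n ⟨
    a % n            ≡⟨ [m+kn]%n≡m%n a m n ⟨
    (a + m * n) % n  ≡⟨ cong (_% n) eq ⟩
    (a' + m' * n) % n ≡⟨ [m+kn]%n≡m%n a' m' n ⟩
    a' % n           ≡⟨ m<n⇒m%n≡m a'<n ⟩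
    a'               ∎

module BaseDigits (n : ℕ) where

  code : ℕ → ℕ → ℕ → ℕ
  code a b s = a + (b + s * n) * n

  code-injective : ∀ {a b a' b'} s s' → a < n → b < n → a' < n → b' < n →
                   code a b s ≡ code a' b' s' → a ≡ a' × b ≡ b' × s ≡ s'
  code-injective {b = b} {b' = b'} s s' a<n b<n a'<n b'<n eq
    with digits-unique (b + s * n) (b' + s' * n) a<n a'<n eq
  ... | a≡a' , eq′ with digits-unique s s' b<n b'<n eq′
  ... | b≡b' , s≡s' = a≡a' , b≡b' , s≡s'

  code-injectiveʳ : ∀ {a b} s s' → a < n → b < n → code a b s ≡ code a b s' → s ≡ s'
  code-injectiveʳ s s' a<n b<n = proj₂ ∘ proj₂ ∘ code-injective s s' a<n b<n a<n b<n

a*b≡k⇒a²b²≡k² : ∀ a b {k} → a * b ≡ k → (a * a) * (b * b) ≡ k * k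
a*b≡k⇒a²b²≡k² a b ab≡k = trans ([m*n]*[o*p]≡[m*o]*[n*p] a a b b) (cong₂ _*_ ab≡k ab≡k)

module _ {k : ℕ} (k-nonsquare : ¬ IsPerfectSquare k) where

  below-√ : ℕ → Bool
  below-√ a = ⌊ a * a <? k ⌋

  above-√ : ∀ a → ¬ a * a < k → k < a * a
  above-√ a a²≮k = ≤∧≢⇒< (≮⇒≥ a²≮k) (λ k≡a² → k-nonsquare (a , sym k≡a²))

  factors-straddle-√ : ∀ a b → a * b ≡ k → below-√ a ≢ below-√ b
  factors-straddle-√ a b ab≡k with a * a <? k | b * b <? k
  ... | yes a²<k | yes b²<k = λ _ → <-irrefl (a*b≡k⇒a²b²≡k² a b ab≡k) (*-mono-< a²<k b²<k)
  ... | yes _    | no _     = λ ()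
  ... | no _     | yes _    = λ ()
  ... | no a²≮k  | no b²≮k  = λ _ →
    <-irrefl (sym (a*b≡k⇒a²b²≡k² a b ab≡k)) (*-mono-< (above-√ a a²≮k) (above-√ b b²≮k))

  stronglyUniform⇒bipartite : (G : Graph) → HasStronglyUniformIASI G k → Bipartite G
  stronglyUniform⇒bipartite G (I , strong , uniform) =
    (λ u → below-√ (card (f u))) ,
    (λ u v e → factors-straddle-√ (card (f u)) (card (f v))
                                  (trans (sym (strong u v e)) (uniform u v e)))
    where open IASI I

SameEnds : ∀ {A : Set} → A → A → A → A → Set
SameEnds u v p q = (u ≡ p × v ≡ q) ⊎ (u ≡ q × v ≡ p)

SameEnds-shared : ∀ {A : Set} {u v u' v' p q : A} →
                 SameEnds u v p q → SameEnds u' v' p q → SameEnds u v u' v'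
SameEnds-shared (inj₁ (refl , refl)) (inj₁ (refl , refl)) = inj₁ (refl , refl)
SameEnds-shared (inj₁ (refl , refl)) (inj₂ (refl , refl)) = inj₂ (refl , refl)
SameEnds-shared (inj₂ (refl , refl)) (inj₁ (refl , refl)) = inj₂ (refl , refl)
SameEnds-shared (inj₂ (refl , refl)) (inj₂ (refl , refl)) = inj₁ (refl , refl)

module BipartiteLabelling (G : Graph) {k : ℕ} (k>0 : k > 0)
                          (c : Fin (Graph.n G) → Bool)
                          (proper : ∀ u v → Edge G u v → c u ≢ c v) where
  open Graph G using (n)
  open BaseDigits n

  vertexCode : Bool → ℕ → ℕ → ℕ
  vertexCode false w t = w
  vertexCode true  w t = code 0 w (suc t)

  labelSize : Bool → ℕ
  labelSize false = 1
  labelSize true  = k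

  label : Fin n → FinSet
  label w = map (vertexCode (c w) (toℕ w)) (upTo (labelSize (c w)))

  edgeLabel : Fin n → Fin n → FinSet
  edgeLabel p q = map (λ t → code (toℕ p) (toℕ q) (suc t)) (upTo k)

  0<n : Fin n → 0 < n
  0<n w = ≤-<-trans z≤n (toℕ<n w)

  vertexCode-injective : ∀ b b' (w w' : Fin n) {t t'} →
                         vertexCode b (toℕ w) t ≡ vertexCode b' (toℕ w') t' → w ≡ w'
  vertexCode-injective false false w w' eq = toℕ-injective eq
  vertexCode-injective true  true  w w' {t} {t'} eq =
    toℕ-injective (proj₁ (proj₂
      (code-injective (suc t) (suc t') (0<n w) (toℕ<n w) (0<n w) (toℕ<n w') eq)))
  -- w = code w 0 0, and the high part 0 differs from suc t.
  vertexCode-injective false true  w w' {t' = t'} eq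
    with () ← proj₂ (proj₂ (code-injective 0 (suc t') (toℕ<n w) (0<n w) (0<n w) (toℕ<n w')
                                             (trans (+-identityʳ _) eq)))
  vertexCode-injective true  false w w' {t} eq
    with () ← proj₂ (proj₂ (code-injective (suc t) 0 (0<n w) (toℕ<n w) (toℕ<n w') (0<n w)
                                             (trans eq (sym (+-identityʳ _)))))

  card-label : ∀ w → card (label w) ≡ labelSize (c w)
  card-label w with c w
  ... | false = refl
  ... | true  = card-map-upTo
    (λ {t} {t'} → suc-injective ∘ code-injectiveʳ (suc t) (suc t') (0<n w) (toℕ<n w)) k

  labelSize-product : ∀ {b b'} → b ≢ b' → labelSize b * labelSize b' ≡ k
  labelSize-product {false} {false} b≢b' = contradiction refl b≢b'
  labelSize-product {false} {true}  _    = *-identityˡ k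
  labelSize-product {true}  {false} _    = *-identityʳ k
  labelSize-product {true}  {true}  b≢b' = contradiction refl b≢b'

  labelSize>0 : ∀ b → labelSize b > 0
  labelSize>0 false = s≤s z≤n
  labelSize>0 true  = k>0

  least∈label : ∀ w → vertexCode (c w) (toℕ w) 0 ∈ label w
  least∈label w = ∈-map⁺ (vertexCode (c w) (toℕ w)) (∈-upTo⁺ (labelSize>0 (c w)))

  label-nonEmpty : ∀ w → label w ≢ []
  label-nonEmpty w eq = ¬Any[] (subst (vertexCode (c w) (toℕ w) 0 ∈_) eq (least∈label w))

  label-injective : ∀ u v → label u ≐ label v → u ≡ v
  label-injective u v eq with ∈-map⁻ (vertexCode (c v) (toℕ v)) (proj₁ (eq _) (least∈label u))
  ... | _ , _ , eq′ = vertexCode-injective (c u) (c v) u v eq′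

  sumset-edge : ∀ u v → Edge G u v →
                Σ (Fin n) λ p → Σ (Fin n) λ q →
                  SameEnds u v p q × label u ⊕ label v ≡ edgeLabel p q
  sumset-edge u v e with c u | c v | proper u v e
  ... | false | false | ≢ = contradiction refl ≢
  ... | true  | true  | ≢ = contradiction refl ≢
  ... | false | true  | _ = u , v , inj₁ (refl , refl) ,
    trans (⊕-singletonˡ (toℕ u) _) (sym (map-∘ (upTo k)))
  ... | true  | false | _ = v , u , inj₂ (refl , refl) ,
    trans (⊕-singletonʳ _ (toℕ v))
          (trans (sym (map-∘ (upTo k))) (map-cong (λ t → +-comm _ (toℕ v)) (upTo k)))

  edgeLabel-injective : ∀ p q p' q' → edgeLabel p q ≐ edgeLabel p' q' → p ≡ p' × q ≡ q'
  edgeLabel-injective p q p' q' eq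
    with ∈-map⁻ (λ t → code (toℕ p') (toℕ q') (suc t))
                (proj₁ (eq _) (∈-map⁺ (λ t → code (toℕ p) (toℕ q) (suc t)) (∈-upTo⁺ k>0)))
  ... | t' , _ , eq′ with code-injective 1 (suc t') (toℕ<n p) (toℕ<n q) (toℕ<n p') (toℕ<n q') eq′
  ... | p≡p' , q≡q' , _ = toℕ-injective p≡p' , toℕ-injective q≡q'

  card-sumset : ∀ u v → Edge G u v → card (label u ⊕ label v) ≡ k
  card-sumset u v e with sumset-edge u v e
  ... | p , q , _ , sum≡ rewrite sum≡ =
    card-map-upTo
      (λ {t} {t'} → suc-injective ∘ code-injectiveʳ (suc t) (suc t') (toℕ<n p) (toℕ<n q)) k

  sumset-injective : ∀ u v u' v' → Edge G u v → Edge G u' v' →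
                     (label u ⊕ label v) ≐ (label u' ⊕ label v') → SameEnds u v u' v'
  sumset-injective u v u' v' e e' eq with sumset-edge u v e | sumset-edge u' v' e'
  ... | p , q , ends , sum≡ | p' , q' , ends' , sum≡'
    with edgeLabel-injective p q p' q' (subst₂ _≐_ sum≡ sum≡' eq)
  ... | refl , refl = SameEnds-shared ends ends'

  strong : ∀ u v → Edge G u v → card (label u ⊕ label v) ≡ card (label u) * card (label v)
  strong u v e = begin
    card (label u ⊕ label v)                ≡⟨ card-sumset u v e ⟩
    k                                       ≡⟨ labelSize-product (proper u v e) ⟨
    labelSize (c u) * labelSize (c v)       ≡⟨ cong₂ _*_ (card-label u) (card-label v) ⟨
    card (label u) * card (label v)         ∎
    where open ≡-Reasoning

  stronglyUniform : HasStronglyUniformIASI G k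
  stronglyUniform = record { f = label ; nonEmpty = label-nonEmpty ; f-inj = label-injective
                           ; f⁺-inj = sumset-injective }
                  , strong , card-sumset

bipartite⇒stronglyUniform : ∀ {k} → k > 0 → (G : Graph) → Bipartite G → HasStronglyUniformIASI G k
bipartite⇒stronglyUniform k>0 G (c , proper) = BipartiteLabelling.stronglyUniform G k>0 c proper

corollary4 : (k : ℕ) → k > 0 → ¬ IsPerfectSquare k → (G : Graph) →
    HasStronglyUniformIASI G k ⇔ Bipartite G
corollary4 k k>0 k-nonsquare G =
  mk⇔ (stronglyUniform⇒bipartite k-nonsquare G) (bipartite⇒stronglyUniform k>0 G)
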